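{- Let $H$ be a peg solitaire board with $N\ge 2$ holes, let $h\in H$ be a hole, let $b_0$ be the board position with a peg in every hole except $h$, and let $b_1=\overline{b_0}$ be the board position with a single peg at $h$. Define $F_{N-1}=\{b_0\}$ and $F_n=D(F_{n+1})$ for $n=N-2,N-3,\ldots,1$; define $B_1=\{b_1\}$ and $B_n=\overline{D(\overline{B_{n-1}})}$ for $n=2,3,\ldots,N-1$; and set $W_n=F_n\cap B_n$ for $1\le n\le N-1$. Then for every $n$ with $1\le n\le N-1$, $$W_n=\overline{W_{N-n}}.$$
   Context: A peg solitaire board is a finite set $H$ of holes, which are points of either the square lattice $\mathbb{Z}^2$ (allowed jump directions: the four unit vectors along rows and columns) or the triangular lattice (allowed jump directions: the six unit vectors parallel to the sides of a triangle); $N=|H|$. A board position is a subset $b\subseteq H$ (the holes containing a peg). A jump is possible in $b$ if there are holes $p,\ q=p+d,\ r=p+2d$ of $H$, with $d$ an allowed direction, such that $p,q\in b$ and $r\notin b$; the jump produces the board position $(b\setminus\{p,q\})\cup\{r\}$ (the peg at $p$ jumps over $q$ into $r$ and the peg at $q$ is removed). For a set $A$ of board positions, $D(A)$ (the descendants of $A$) is the set of all board positions obtained from some element of $A$ by a single jump. The complement of a board position $b$ is $\overline{b}=H\setminus b$, and for a set $A$ of board positions, $\overline{A}=\{\overline{b}: b\in A\}$ (the set of complemented board positions, not the set-theoretic complement of $A$). -}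

module Defs where

open import Data.Nat using (ℕ; zero; suc; _∸_)
open import Data.Integer using (ℤ; +_; -[1+_]; _+_; _*_)
open import Data.Product using (_×_; _,_; Σ; ∃; ∃-syntax)
open import Data.Bool using (Bool; true; false)
open import Data.Fin using (Fin)
open import Data.Fin.Subset using (Subset; ∁)
open import Data.Vec using (lookup; _[_]≔_; replicate)
open import Data.List using (List; []; _∷_)
open import Data.List.Membership.Propositional using (_∈_)
open import Function.Definitions using (Injective)
open import Relation.Binary.PropositionalEquality using (_≡_)

Point : Set
Point = ℤ × ℤ

_⊕_ : Point → Point → Point
(a , b) ⊕ (c , d) = (a + c , b + d)

2·_ : Point → Point
2· (a , b) = (+ 2 * a , + 2 * b)

data Lattice : Set where
  square triangular : Lattice

-- Triangular lattice in axial coordinates (point (a,b) = a·e₁ + b·e₂ with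
-- e₁ = (1,0), e₂ = (1/2, √3/2)): the six unit vectors ±e₁, ±e₂, ±(e₂ − e₁).
directions : Lattice → List Point
directions square =
  (+ 1 , + 0) ∷ (-[1+ 0 ] , + 0) ∷ (+ 0 , + 1) ∷ (+ 0 , -[1+ 0 ]) ∷ []
directions triangular =
  (+ 1 , + 0) ∷ (-[1+ 0 ] , + 0) ∷ (+ 0 , + 1) ∷ (+ 0 , -[1+ 0 ]) ∷
  (-[1+ 0 ] , + 1) ∷ (+ 1 , -[1+ 0 ]) ∷ []

record Board (N : ℕ) : Set where
  field
    lattice : Lattice
    pos     : Fin N → Point
    pos-inj : Injective _≡_ _≡_ pos
open Board public

-- A board position: the subset of holes containing a peg.
Position : ℕ → Set
Position N = Subset N

PosSet : ℕ → Set₁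
PosSet N = Position N → Set

data Jump {N : ℕ} (H : Board N) (b : Position N) : Position N → Set where
  jump : (p q r : Fin N) (d : Point) →
         d ∈ directions (lattice H) →
         pos H q ≡ pos H p ⊕ d →
         pos H r ≡ pos H p ⊕ (2· d) →
         lookup b p ≡ true → lookup b q ≡ true → lookup b r ≡ false →
         Jump H b (((b [ p ]≔ false) [ q ]≔ false) [ r ]≔ true)

D : {N : ℕ} → Board N → PosSet N → PosSet N
D H A b' = ∃[ b ] (A b × Jump H b b')

compl : {N : ℕ} → PosSet N → PosSet N
compl A c = ∃[ b ] (A b × c ≡ ∁ b)

b₀ : {N : ℕ} → Fin N → Position N
b₀ h = replicate _ true [ h ]≔ false

b₁ : {N : ℕ} → Fin N → Position N
b₁ h = ∁ (b₀ h)

-- Fiter k = F_{N-1-k}:  Fiter 0 = {b₀},  Fiter (k+1) = D(Fiter k).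
Fiter : {N : ℕ} → Board N → Fin N → ℕ → PosSet N
Fiter H h zero b = b ≡ b₀ h
Fiter H h (suc k) = D H (Fiter H h k)

-- Biter k = B_{k+1}:  Biter 0 = {b₁},  Biter (k+1) = compl(D(compl(Biter k))).
Biter : {N : ℕ} → Board N → Fin N → ℕ → PosSet N
Biter H h zero b = b ≡ b₁ h
Biter H h (suc k) = compl (D H (compl (Biter H h k)))

F : {N : ℕ} → Board N → Fin N → ℕ → PosSet N
F {N} H h n = Fiter H h (N ∸ 1 ∸ n)

B : {N : ℕ} → Board N → Fin N → ℕ → PosSet N
B H h n = Biter H h (n ∸ 1)

W : {N : ℕ} → Board N → Fin N → ℕ → PosSet N
W H h n b = F H h n b × B H h n b

_≐_ : {N : ℕ} → PosSet N → PosSet N → Set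
A ≐ A' = (∀ b → A b → A' b) × (∀ b → A' b → A b)

-- Complementation carries the forward recursion F ↦ D(F), started at b₀, onto the backward
-- recursion B ↦ \overline{D(\overline{B})}, started at b₁ = b̄₀; so by induction on the number
-- of jumps B_n = \overline{F_{N-n}}. Hence b ∈ F_n ∩ B_n iff b̄ ∈ B_{N-n} ∩ F_{N-n} = W_{N-n}.
module Submission where

open import Defs
open import Data.Nat using (ℕ; _+_; _≤_; _∸_; zero; suc)
open import Data.Nat.Properties using (∸-+-assoc; +-comm; m∸[m∸n]≡n; m∸n≤m; ≤-trans)
open import Data.Fin using (Fin)
open import Data.Fin.Subset using (Subset; ∁)
open import Data.Bool.Properties using (not-involutive)
open import Data.Vec.Properties using (map-∘; map-cong; map-id)
open import Data.Product using (_,_)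
open import Relation.Binary.PropositionalEquality
  using (_≡_; refl; sym; trans; cong; subst; module ≡-Reasoning)

∁-involutive : ∀ {n} (b : Subset n) → ∁ (∁ b) ≡ b
∁-involutive b = trans (sym (map-∘ _ _ b)) (trans (map-cong not-involutive b) (map-id b))

module _ {N : ℕ} {A : PosSet N} where

  ∁-∈-compl : ∀ {b} → A b → compl A (∁ b)
  ∁-∈-compl {b} a = b , a , refl

  ∈-compl-∁ : ∀ {b} → A (∁ b) → compl A b
  ∈-compl-∁ {b} a = ∁ b , a , sym (∁-involutive b)

  ∁∁-∈ : ∀ {b} → A b → A (∁ (∁ b))
  ∁∁-∈ {b} = subst A (sym (∁-involutive b))

module _ {N : ℕ} (H : Board N) (h : Fin N) where

  Fiter⇒Biter-∁ : ∀ k {b} → Fiter H h k b → Biter H h k (∁ b)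
  Fiter⇒Biter-∁ zero    refl          = refl
  Fiter⇒Biter-∁ (suc k) (a , Fa , a↝b) =
    ∁-∈-compl (a , ∈-compl-∁ (Fiter⇒Biter-∁ k Fa) , a↝b)

  Biter⇒Fiter-∁ : ∀ k {b} → Biter H h k b → Fiter H h k (∁ b)
  Biter⇒Fiter-∁ zero    refl = ∁-involutive (b₀ h)
  Biter⇒Fiter-∁ (suc k) (c , (_ , (a , Ba , refl) , ∁a↝c) , refl) =
    ∁∁-∈ {A = Fiter H h (suc k)} (∁ a , Biter⇒Fiter-∁ k Ba , ∁a↝c)

m∸n∸o≡m∸o∸n : ∀ m n o → m ∸ n ∸ o ≡ m ∸ o ∸ n
m∸n∸o≡m∸o∸n m n o = begin
  m ∸ n ∸ o    ≡⟨ ∸-+-assoc m n o ⟩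
  m ∸ (n + o)  ≡⟨ cong (m ∸_) (+-comm n o) ⟩
  m ∸ (o + n)  ≡⟨ ∸-+-assoc m o n ⟨
  m ∸ o ∸ n    ∎
  where open ≡-Reasoning

m∸1∸[m∸n]≡n∸1 : ∀ {m n} → n ≤ m → m ∸ 1 ∸ (m ∸ n) ≡ n ∸ 1
m∸1∸[m∸n]≡n∸1 {m} {n} n≤m =
  trans (m∸n∸o≡m∸o∸n m 1 (m ∸ n)) (cong (_∸ 1) (m∸[m∸n]≡n n≤m))

W⇒W-∁ : ∀ {N} (H : Board N) (h : Fin N) {n b} → n ≤ N → W H h n b → W H h (N ∸ n) (∁ b)
W⇒W-∁ {N} H h {n} {b} n≤N (Fb , Bb) =
    subst (λ k → Fiter H h k (∁ b)) (sym (m∸1∸[m∸n]≡n∸1 n≤N)) (Biter⇒Fiter-∁ H h (n ∸ 1) Bb)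
  , subst (λ k → Biter H h k (∁ b)) (m∸n∸o≡m∸o∸n N 1 n) (Fiter⇒Biter-∁ H h (N ∸ 1 ∸ n) Fb)

mainTheorem1 : {N : ℕ} → 2 ≤ N → (H : Board N) → (h : Fin N) →
               (n : ℕ) → 1 ≤ n → n ≤ N ∸ 1 →
               W H h n ≐ compl (W H h (N ∸ n))
mainTheorem1 {N} _ H h n _ n≤N∸1 =
    (λ b Wb → ∈-compl-∁ {A = W H h (N ∸ n)} (W⇒W-∁ H h n≤N Wb))
  , λ { b (c , Wc , refl) →
          subst (λ k → W H h k (∁ c)) (m∸[m∸n]≡n n≤N) (W⇒W-∁ H h (m∸n≤m N n) Wc) }
  where n≤N : n ≤ N
        n≤N = ≤-trans n≤N∸1 (m∸n≤m N 1)
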